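{- Let $G$ be a partial cube and $H$ a gated subgraph of $G$. If $D\subseteq \mathrm{cross}(H)$ is shattered by $G$, then $D$ is shattered by $H$.
   Context: A partial cube is a graph $G$ given as an isometric subgraph of a hypercube whose vertices are $\{\pm1\}^U$. For $e\in U$, $E_e$ is the set of edges of $G$ whose endpoints differ in coordinate $e$; $\mathrm{cross}(H)$ is the set of $e$ such that the (induced) subgraph $H$ contains an edge of $E_e$. $H$ is gated if for every vertex $x$ of $G$ there is a vertex $x'\in H$ such that $x'$ lies on a shortest path between $x$ and $y$ for every vertex $y$ of $H$. A set $D\subseteq U$ is shattered by a graph whose vertices are $\{\pm1\}$-vectors if for every $Z\in\{\pm1\}^D$ some vertex restricts to $Z$ on $D$. -}

module Defs where

open import Data.Nat using (ℕ; zero; suc; _+_; _≤_)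
open import Data.Bool using (Bool; true; false; if_then_else_)
open import Data.Bool.Properties using (_≟_)
open import Data.Fin using (Fin; zero; suc)
open import Data.Fin.Subset using (Subset; _∈_)
open import Data.Product using (Σ; ∃; _×_; _,_)
open import Relation.Binary.PropositionalEquality using (_≡_; _≢_)
open import Relation.Nullary using (does)
open import Level using (Level; _⊔_) renaming (suc to lsuc)

-- Vertices of the hypercube {±1}^U with U = Fin n  (true ~ +1, false ~ -1).
Cube : ℕ → Set
Cube n = Fin n → Bool

hamming : ∀ {n} → Cube n → Cube n → ℕ
hamming {zero}  x y = 0
hamming {suc n} x y =
  (if does (x zero ≟ y zero) then 0 else 1) + hamming (λ i → x (suc i)) (λ i → y (suc i))

record CubeGraph (n : ℕ) : Set₁ where
  field
    V : Cube n → Set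
    E : Cube n → Cube n → Set
    E-sym : ∀ {x y} → E x y → E y x
    E-V₁ : ∀ {x y} → E x y → V x
    E-V₂ : ∀ {x y} → E x y → V y
open CubeGraph public

data Walk {n} (G : CubeGraph n) : Cube n → Cube n → ℕ → Set where
  here : ∀ {x} → V G x → Walk G x x 0
  step : ∀ {x z y k} → E G x z → Walk G z y k → Walk G x y (suc k)

Dist : ∀ {n} → CubeGraph n → Cube n → Cube n → ℕ → Set
Dist G x y k = Walk G x y k × (∀ m → Walk G x y m → k ≤ m)

IsCubeSubgraph : ∀ {n} → CubeGraph n → Set
IsCubeSubgraph G = ∀ {x y} → E G x y → hamming x y ≡ 1

IsPartialCube : ∀ {n} → CubeGraph n → Set
IsPartialCube G =
  IsCubeSubgraph G × (∀ x y → V G x → V G y → Dist G x y (hamming x y))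

induced : ∀ {n} (G : CubeGraph n) (W : Cube n → Set) → (∀ {x} → W x → V G x) → CubeGraph n
induced G W _ = record
  { V = W
  ; E = λ x y → W x × W y × E G x y
  ; E-sym = λ { (wx , wy , e) → wy , wx , E-sym G e }
  ; E-V₁ = λ { (wx , _ , _) → wx }
  ; E-V₂ = λ { (_ , wy , _) → wy } }

OnShortestPath : ∀ {n} → CubeGraph n → Cube n → Cube n → Cube n → Set
OnShortestPath G x z y =
  Σ ℕ λ a → Σ ℕ λ b → Dist G x z a × Dist G z y b × Dist G x y (a + b)

Gated : ∀ {n} → CubeGraph n → (Cube n → Set) → Set
Gated {n} G W =
  ∀ x → V G x → Σ (Cube n) λ x' → W x' × (∀ y → W y → OnShortestPath G x x' y)

Cross : ∀ {n} → CubeGraph n → Fin n → Set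
Cross H e = Σ _ λ x → Σ _ λ y → E H x y × x e ≢ y e

Shattered : ∀ {n} → CubeGraph n → Subset n → Set
Shattered {n} G D =
  (Z : Cube n) → Σ (Cube n) λ x → V G x × (∀ e → e ∈ D → x e ≡ Z e)

-- The gate x' of a vertex x lies on a shortest path from x to every vertex of H.
-- In a partial cube graph distances are Hamming distances, so x' lies in the
-- Hamming interval between x and each y ∈ H, i.e. x' agrees with x on every
-- coordinate where x and y agree. For e ∈ cross(H), H contains vertices with
-- both signs at e, so some y ∈ H agrees with x at e, and hence x'_e = x_e.
-- Given Z, take x ∈ G agreeing with Z on D ⊆ cross(H); its gate is the vertex
-- of H required for Z.
module Submission where

open import Defs
open import Data.Nat using (ℕ; zero; suc; _+_; _≤_; _<_; s≤s; z≤n)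
open import Data.Nat.Properties
  using (≤-antisym; ≤-refl; <-irrefl; +-mono-≤; +-mono-<-≤; +-mono-≤-<; +-commutativeSemigroup)
open import Algebra.Properties.CommutativeSemigroup +-commutativeSemigroup using (interchange)
open import Data.Fin using (zero; suc)
open import Data.Fin.Subset using (Subset; _∈_)
open import Data.Bool using (Bool; true; false; if_then_else_)
import Data.Bool as Bool
open import Data.Bool.Properties using (_≟_; ¬-not)
open import Data.Product using (_,_)
open import Data.Sum using (_⊎_; inj₁; inj₂; [_,_])
open import Function using (_∘_)
open import Relation.Binary.PropositionalEquality using (_≡_; _≢_; refl; sym; trans; cong₂; module ≡-Reasoning)
open import Relation.Nullary using (does; yes; no; contradiction)

≡-either : ∀ {a b c : Bool} → b ≢ c → a ≡ b ⊎ a ≡ c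
≡-either {a} {b} b≢c with a Bool.≟ b
... | yes a≡b = inj₁ a≡b
... | no  a≢b = inj₂ (trans (¬-not a≢b) (sym (¬-not (b≢c ∘ sym))))

mismatch : Bool → Bool → ℕ
mismatch a b = if does (a ≟ b) then 0 else 1

mismatch-triangle : ∀ a b c → mismatch a c ≤ mismatch a b + mismatch b c
mismatch-triangle false false false = z≤n
mismatch-triangle false false true  = ≤-refl
mismatch-triangle false true  false = z≤n
mismatch-triangle false true  true  = ≤-refl
mismatch-triangle true  false false = ≤-refl
mismatch-triangle true  false true  = z≤n
mismatch-triangle true  true  false = ≤-refl
mismatch-triangle true  true  true  = z≤n

mismatch-triangle-strict : ∀ {a b} c → a ≡ b → c ≢ a → mismatch a b < mismatch a c + mismatch c b
mismatch-triangle-strict {false} false refl c≢a = contradiction refl c≢a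
mismatch-triangle-strict {false} true  refl _   = s≤s z≤n
mismatch-triangle-strict {true}  false refl _   = s≤s z≤n
mismatch-triangle-strict {true}  true  refl c≢a = contradiction refl c≢a

tail : ∀ {n} → Cube (suc n) → Cube n
tail x i = x (suc i)

-- On Cube (suc n), hamming unfolds definitionally to the head mismatch plus the hamming distance of the tails.
split-sum : ∀ {n} (x z y : Cube (suc n)) →
  hamming x z + hamming z y ≡
  (mismatch (x zero) (z zero) + mismatch (z zero) (y zero))
    + (hamming (tail x) (tail z) + hamming (tail z) (tail y))
split-sum x z y = interchange (mismatch (x zero) (z zero)) (hamming (tail x) (tail z))
                              (mismatch (z zero) (y zero)) (hamming (tail z) (tail y))

hamming-triangle : ∀ {n} (x z y : Cube n) → hamming x y ≤ hamming x z + hamming z y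
hamming-triangle {zero}  x z y = z≤n
hamming-triangle {suc n} x z y rewrite split-sum x z y =
  +-mono-≤ (mismatch-triangle (x zero) (z zero) (y zero)) (hamming-triangle (tail x) (tail z) (tail y))

hamming-triangle-strict : ∀ {n} (x z y : Cube n) e → x e ≡ y e → z e ≢ x e →
  hamming x y < hamming x z + hamming z y
hamming-triangle-strict x z y zero x≡y z≢x rewrite split-sum x z y =
  +-mono-<-≤ (mismatch-triangle-strict (z zero) x≡y z≢x) (hamming-triangle (tail x) (tail z) (tail y))
hamming-triangle-strict x z y (suc e) x≡y z≢x rewrite split-sum x z y =
  +-mono-≤-< (mismatch-triangle (x zero) (z zero) (y zero))
             (hamming-triangle-strict (tail x) (tail z) (tail y) e x≡y z≢x)

hamming-between⇒agree : ∀ {n} (x z y : Cube n) e →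
  hamming x y ≡ hamming x z + hamming z y → x e ≡ y e → z e ≡ x e
hamming-between⇒agree x z y e between x≡y with z e Bool.≟ x e
... | yes z≡x = z≡x
... | no  z≢x = contradiction (hamming-triangle-strict x z y e x≡y z≢x) (<-irrefl between)

Dist-unique : ∀ {n} {G : CubeGraph n} {x y k m} → Dist G x y k → Dist G x y m → k ≡ m
Dist-unique (walk₁ , shortest₁) (walk₂ , shortest₂) = ≤-antisym (shortest₁ _ walk₂) (shortest₂ _ walk₁)

onShortestPath⇒hamming-between : ∀ {n} {G : CubeGraph n} → IsPartialCube G →
  ∀ {x z y} → V G x → V G z → V G y → OnShortestPath G x z y →
  hamming x y ≡ hamming x z + hamming z y
onShortestPath⇒hamming-between (_ , isometric) {x} {z} {y} vx vz vy (a , b , dxz , dzy , dxy) =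
  begin
    hamming x y                  ≡⟨ Dist-unique (isometric x y vx vy) dxy ⟩
    a + b                        ≡⟨ cong₂ _+_ (Dist-unique dxz (isometric x z vx vz))
                                              (Dist-unique dzy (isometric z y vz vy)) ⟩
    hamming x z + hamming z y    ∎
  where open ≡-Reasoning

gate-agrees-at : ∀ {n} {G : CubeGraph n} → IsPartialCube G →
  {W : Cube n → Set} (W⊆V : ∀ {x} → W x → V G x) →
  ∀ {x x'} → V G x → W x' → (∀ y → W y → OnShortestPath G x x' y) →
  ∀ {y} e → W y → x e ≡ y e → x' e ≡ x e
gate-agrees-at partial W⊆V {x} {x'} vx wx' gate {y} e wy =
  hamming-between⇒agree x x' y e
    (onShortestPath⇒hamming-between partial vx (W⊆V wx') (W⊆V wy) (gate y wy))

gate-agrees-on-cross : ∀ {n} {G : CubeGraph n} → IsPartialCube G →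
  {W : Cube n → Set} (W⊆V : ∀ {x} → W x → V G x) →
  ∀ {x x'} → V G x → W x' → (∀ y → W y → OnShortestPath G x x' y) →
  ∀ e → Cross (induced G W W⊆V) e → x' e ≡ x e
gate-agrees-on-cross partial W⊆V vx wx' gate e (_ , _ , (wy , wy' , _) , y≢y') =
  [ gate-agrees-at partial W⊆V vx wx' gate e wy
  , gate-agrees-at partial W⊆V vx wx' gate e wy'
  ] (≡-either y≢y')

lemma13 : ∀ {n} (G : CubeGraph n) → IsPartialCube G →
    (W : Cube n → Set) (W⊆V : ∀ {x} → W x → V G x) → Gated G W →
    (D : Subset n) → (∀ e → e ∈ D → Cross (induced G W W⊆V) e) →
    Shattered G D → Shattered (induced G W W⊆V) D
lemma13 G partial W W⊆V gated D D⊆cross shattered Z with shattered Z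
... | x , vx , x≡Z with gated x vx
... | x' , wx' , gate = x' , wx' , λ e e∈D →
  trans (gate-agrees-on-cross partial W⊆V vx wx' gate e (D⊆cross e e∈D)) (x≡Z e e∈D)
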